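{- Let $\Sigma,\Gamma$ be as in the context and $t\geq1$. For every normal $t$-formula $\alpha$ and all streams $\mathbf I,\mathbf J$, $\mathbf I\subseteq\mathbf J$ implies $\mathrm M_{\mathbf I,t}(\alpha)\subseteq\mathrm M_{\mathbf J,t}(\alpha)$ and $\mathrm{MM}_{\mathbf I,t}(\alpha)\subseteq\mathrm{MM}_{\mathbf J,t}(\alpha)$. Moreover, for every stream $\mathbf I$ and all finite sets $A\subseteq B$ of normal $t$-formulas, $\mathrm M_{\mathbf I,t}(A)\subseteq\mathrm M_{\mathbf I,t}(B)$ and $\mathrm{MM}_{\mathbf I,t}(A)\subseteq\mathrm{MM}_{\mathbf I,t}(B)$.
   Context: $\Sigma$ is a finite nonempty set of propositional atoms containing a special symbol $\top$. Formulas: $\alpha::=a\mid\neg\alpha\mid\alpha\land\alpha\mid\alpha\lor\alpha\mid\alpha\rightarrow\alpha\mid\Diamond\alpha\mid\Box\alpha\mid @_{t'}\alpha\mid\boxplus_{[\ell,r]}\alpha$ with $a\in\Sigma$, integer $t'\geq1$, $\ell,r\in\mathbb N\cup\{\infty\}$, $\ell\leq r$. Normal: none of $\neg,\lor,\rightarrow,\Diamond$. A stream is $\mathbf I=I_1I_2\ldots$ with $I_s\subseteq\Sigma$; $\subseteq$, $\cup$ pointwise; $\emptyset$ all-empty; $\{a\}_s$ has $\{a\}$ at $s$, $\emptyset$ elsewhere. $\mathrm{supp}\,\mathbf I$: tightest interval containing $\{s\mid I_s\neq\emptyset\}$, $\mathrm{supp}\,\emptyset=\emptyset$. $\mathbf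 I[\ell,r;s]$ agrees with $\mathbf I$ at $u$ with $s-\ell\leq u\leq s+r$, empty elsewhere. Fix $\Gamma\subseteq\Sigma$. Entailment: $\mathbf I,s\models_\Gamma\top$; for $a\neq\top$, $\mathbf I,s\models_\Gamma a$ iff $a\in I_s\cup\Gamma$; $\neg,\land,\lor,\rightarrow$ classically; $\Diamond\alpha$/$\Box\alpha$ at $s$ iff $\alpha$ at some/every $s'\in\mathrm{supp}\,\mathbf I$; $@_{s'}\alpha$ at $s$ iff $\alpha$ at $s'$; $\mathbf I,s\models_\Gamma\boxplus_{[\ell,r]}\alpha$ iff $\mathbf I[\ell,r;s],s\models_\Gamma\alpha$. A normal $t$-formula is a normal formula having some stream satisfying it at $t$. Partial model operator: $\mathrm M_{\mathbf I,s}(a)=\{a\}_s$ if $a\notin\Gamma$, $\emptyset$ if $a\in\Gamma$; $\mathrm M_{\mathbf I,s}(\alpha\land\beta)=\mathrm M_{\mathbf I,s}(\alpha)\cup\mathrm M_{\mathbf I,s}(\beta)$; $\mathrm M_{\mathbf I,s}(\Box\alpha)=\bigcup_{s'\in\mathrm{supp}\,\mathbf I}\mathrm M_{\mathbf I,s'}(\alpha)$; $\mathrm M_{\mathbf I,s}(@_{s'}\alpha)=\mathrm M_{\mathbf I,s'}(\alpha)$; $\mathrm M_{\mathbf I,s}(\boxplus_{[\ell,r]}\alpha)=\mathrm M_{\mathbf I[\ell,r;s],s}(\alpha)$; for a finite set $A$, $\mathrm M_{\mathbf I,s}(A)=\bigcup_{\alpha\in A}\mathrm M_{\mathbf I,s}(\alpha)$.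 $\mathrm{MM}_{\mathbf I,s}(X)=\mathrm M_{\mathrm M_{\mathbf I,s}(X),s}(X)$. -}

module Defs where

open import Data.Nat using (ℕ; zero; suc; _+_; _≤_)
open import Data.Fin using (Fin; zero; suc)
open import Data.Product using (Σ; ∃; _×_; _,_)
open import Data.Sum using (_⊎_)
open import Data.Unit using (⊤)
open import Data.Empty using (⊥)
open import Data.List using (List)
open import Data.List.Membership.Propositional using (_∈_)
open import Relation.Nullary using (¬_)
open import Relation.Binary.PropositionalEquality using (_≡_)

-- Conventions:
--  * Σ = Fin (suc n) (a finite nonempty set of atoms); the special atom ⊤ is 'zero'.
--  * Γ ⊆ Σ is a predicate  Fin (suc n) → Set.
--  * Time points 1,2,3,... are represented by ℕ via  p ↦ p+1  (so Pos 0 is time 1).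
--  * A stream I₁I₂… is a function  Pos → (Atom → Set)  (subset of Σ at each time).

Atom : ℕ → Set
Atom n = Fin (suc n)

⊤ₐ : ∀ {n} → Atom n
⊤ₐ = zero

Pos : Set
Pos = ℕ

Stream : ℕ → Set₁
Stream n = Pos → Atom n → Set

_⊆ˢ_ : ∀ {n} → Stream n → Stream n → Set
I ⊆ˢ J = ∀ p a → I p a → J p a

∅ˢ : ∀ {n} → Stream n
∅ˢ _ _ = ⊥

_∪ˢ_ : ∀ {n} → Stream n → Stream n → Stream n
(I ∪ˢ J) p a = I p a ⊎ J p a

single : ∀ {n} → Atom n → Pos → Stream n
single a s p b = (p ≡ s) × (b ≡ a)

NonEmptyAt : ∀ {n} → Stream n → Pos → Set
NonEmptyAt {n} I p = ∃ λ (a : Atom n) → I p a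

-- s ∈ supp I : s lies in the tightest interval containing all
-- positions where I is nonempty (its convex hull); supp ∅ = ∅.
InSupp : ∀ {n} → Stream n → Pos → Set
InSupp I s = (∃ λ u → u ≤ s × NonEmptyAt I u) × (∃ λ v → s ≤ v × NonEmptyAt I v)

data ℕ∞ : Set where
  fin : ℕ → ℕ∞
  ∞   : ℕ∞

data _≤∞_ : ℕ∞ → ℕ∞ → Set where
  fin≤fin : ∀ {m k} → m ≤ k → fin m ≤∞ fin k
  ≤∞∞     : ∀ {m} → m ≤∞ ∞

LowerOK : ℕ∞ → Pos → Pos → Set
LowerOK (fin ℓ) s u = s ≤ u + ℓ
LowerOK ∞       s u = ⊤

UpperOK : ℕ∞ → Pos → Pos → Set
UpperOK (fin r) s u = u ≤ s + r
UpperOK ∞       s u = ⊤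

window : ∀ {n} → Stream n → ℕ∞ → ℕ∞ → Pos → Stream n
window I ℓ r s u a = (LowerOK ℓ s u × UpperOK r s u) × I u a

-- Formulas (the time index of @ is a Pos, i.e. an integer t' ≥ 1 shifted by one)
data Fm (n : ℕ) : Set where
  atom : Atom n → Fm n
  ¬ᶠ_  : Fm n → Fm n
  _∧ᶠ_ : Fm n → Fm n → Fm n
  _∨ᶠ_ : Fm n → Fm n → Fm n
  _⇒ᶠ_ : Fm n → Fm n → Fm n
  ◇_   : Fm n → Fm n
  □_   : Fm n → Fm n
  at[_]_ : Pos → Fm n → Fm n
  ⊞[_,_]⟨_⟩_ : (ℓ r : ℕ∞) → ℓ ≤∞ r → Fm n → Fm n

data Normal {n : ℕ} : Fm n → Set where
  atom : ∀ a → Normal (atom a)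
  and  : ∀ {α β} → Normal α → Normal β → Normal (α ∧ᶠ β)
  box  : ∀ {α} → Normal α → Normal (□ α)
  at   : ∀ {t α} → Normal α → Normal (at[ t ] α)
  win  : ∀ {ℓ r h α} → Normal α → Normal (⊞[ ℓ , r ]⟨ h ⟩ α)

module _ {n : ℕ} (Γ : Atom n → Set) where

  Sat : Stream n → Pos → Fm n → Set
  Sat I s (atom zero)    = ⊤
  Sat I s (atom (suc a)) = I s (suc a) ⊎ Γ (suc a)
  Sat I s (¬ᶠ α)         = ¬ Sat I s α
  Sat I s (α ∧ᶠ β)       = Sat I s α × Sat I s β
  Sat I s (α ∨ᶠ β)       = Sat I s α ⊎ Sat I s β
  Sat I s (α ⇒ᶠ β)       = Sat I s α → Sat I s β
  Sat I s (◇ α)          = ∃ λ s' → InSupp I s' × Sat I s' α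
  Sat I s (□ α)          = ∀ s' → InSupp I s' → Sat I s' α
  Sat I s (at[ t ] α)     = Sat I t α
  Sat I s (⊞[ ℓ , r ]⟨ _ ⟩ α) = Sat (window I ℓ r s) s α

  NormalT : Pos → Fm n → Set₁
  NormalT t α = Normal α × Σ (Stream n) (λ I → Sat I t α)

  -- partial model operator M_{I,s}(α); only meaningful on normal formulas
  -- (non-normal connectives are mapped to the empty stream)
  M : Stream n → Pos → Fm n → Stream n
  M I s (atom a) p b = (¬ Γ a) × single a s p b
  M I s (¬ᶠ α)       = ∅ˢ
  M I s (α ∧ᶠ β)     = M I s α ∪ˢ M I s β
  M I s (α ∨ᶠ β)     = ∅ˢ
  M I s (α ⇒ᶠ β)     = ∅ˢ
  M I s (◇ α)        = ∅ˢ
  M I s (□ α) p b    = ∃ λ s' → InSupp I s' × M I s' α p b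
  M I s (at[ t ] α)   = M I t α
  M I s (⊞[ ℓ , r ]⟨ _ ⟩ α) = M (window I ℓ r s) s α

  MM : Stream n → Pos → Fm n → Stream n
  MM I s α = M (M I s α) s α

  MSet : Stream n → Pos → List (Fm n) → Stream n
  MSet I s A p b = ∃ λ α → α ∈ A × M I s α p b

  MMSet : Stream n → Pos → List (Fm n) → Stream n
  MMSet I s A = MSet (MSet I s A) s A

module Submission where

open import Defs
open import Data.Nat using (ℕ)
open import Data.Product using (_×_; _,_; proj₁)
open import Data.Sum using (inj₁; inj₂)
open import Data.List using (List)
open import Data.List.Relation.Unary.All using (All; lookup; map)
open import Data.List.Relation.Binary.Subset.Propositional using (_⊆_)

-- M is defined by structural recursion along the formula, and on normal
-- formulas the stream enters only through supports and windows, both of which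
-- grow with the stream; so M, and hence MM = M ∘ M, is monotone in the stream.
-- Monotonicity in the set of formulas is immediate since M on a set is a union.

⊆ˢ-trans : ∀ {n} {I J K : Stream n} → I ⊆ˢ J → J ⊆ˢ K → I ⊆ˢ K
⊆ˢ-trans I⊆J J⊆K p a x = J⊆K p a (I⊆J p a x)

InSupp-mono : ∀ {n} {I J : Stream n} → I ⊆ˢ J → ∀ s → InSupp I s → InSupp J s
InSupp-mono I⊆J s ((u , u≤s , a , Iua) , (v , s≤v , b , Ivb)) =
  (u , u≤s , a , I⊆J u a Iua) , (v , s≤v , b , I⊆J v b Ivb)

window-mono : ∀ {n} {I J : Stream n} → I ⊆ˢ J → ∀ ℓ r s → window I ℓ r s ⊆ˢ window J ℓ r s
window-mono I⊆J ℓ r s p a (inWindow , Ipa) = inWindow , I⊆J p a Ipa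

module _ {n : ℕ} (Γ : Atom n → Set) where

  M-mono : ∀ {α} → Normal α → ∀ {I J : Stream n} → I ⊆ˢ J → ∀ s → M Γ I s α ⊆ˢ M Γ J s α
  M-mono (atom a)    I⊆J s p b x        = x
  M-mono (and nα nβ) I⊆J s p b (inj₁ x) = inj₁ (M-mono nα I⊆J s p b x)
  M-mono (and nα nβ) I⊆J s p b (inj₂ x) = inj₂ (M-mono nβ I⊆J s p b x)
  M-mono (box nα)    I⊆J s p b (s' , s'∈supp , x) =
    s' , InSupp-mono I⊆J s' s'∈supp , M-mono nα I⊆J s' p b x
  M-mono (at {t} nα) I⊆J s = M-mono nα I⊆J t
  M-mono (win {ℓ} {r} nα) I⊆J s = M-mono nα (window-mono I⊆J ℓ r s) s

  MM-mono : ∀ {α} → Normal α → ∀ {I J : Stream n} → I ⊆ˢ J → ∀ s → MM Γ I s α ⊆ˢ MM Γ J s α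
  MM-mono nα I⊆J s = M-mono nα (M-mono nα I⊆J s) s

  MSet-monoˡ : ∀ {A} → All Normal A → ∀ {I J : Stream n} → I ⊆ˢ J → ∀ s →
    MSet Γ I s A ⊆ˢ MSet Γ J s A
  MSet-monoˡ nA I⊆J s p b (α , α∈A , x) = α , α∈A , M-mono (lookup nA α∈A) I⊆J s p b x

  MSet-monoʳ : ∀ {A B} → A ⊆ B → ∀ I s → MSet Γ I s A ⊆ˢ MSet Γ I s B
  MSet-monoʳ A⊆B I s p b (α , α∈A , x) = α , A⊆B α∈A , x

  MMSet-monoʳ : ∀ {A B} → All Normal A → A ⊆ B → ∀ I s → MMSet Γ I s A ⊆ˢ MMSet Γ I s B
  MMSet-monoʳ {B = B} nA A⊆B I s =
    ⊆ˢ-trans (MSet-monoˡ nA (MSet-monoʳ A⊆B I s) s) (MSet-monoʳ A⊆B (MSet Γ I s B) s)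

proposition3 : ∀ {n : ℕ} (Γ : Atom n → Set) (t : Pos) →
    (∀ (α : Fm n) → NormalT Γ t α → ∀ (I J : Stream n) → I ⊆ˢ J →
      (M Γ I t α ⊆ˢ M Γ J t α) × (MM Γ I t α ⊆ˢ MM Γ J t α))
    ×
    (∀ (I : Stream n) (A B : List (Fm n)) →
      All (NormalT Γ t) A → All (NormalT Γ t) B → A ⊆ B →
      (MSet Γ I t A ⊆ˢ MSet Γ I t B) × (MMSet Γ I t A ⊆ˢ MMSet Γ I t B))
proposition3 Γ t =
  (λ α (nα , _) I J I⊆J → M-mono Γ nα I⊆J t , MM-mono Γ nα I⊆J t)
  , λ I A B nA _ A⊆B →
      MSet-monoʳ Γ A⊆B I t , MMSet-monoʳ Γ (map proj₁ nA) A⊆B I t
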